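{- Let $r\geq 2$ and $n\geq 1$ be integers and let $N\geq (r-\frac{1}{2})2n+2$. In every coloring of the edges of $K_N$ with $r$ colors, either (i) for every double star $D$ on $2n+2$ vertices there is a monochromatic copy of $D$, or (ii) every vertex has degree at least $n+1$ and at most $2n$ in every color (i.e. for every vertex $v$ and every color $i$, the number of edges of color $i$ incident to $v$ lies between $n+1$ and $2n$).
   Context: A double star is a tree obtained by joining by an edge the centers of two vertex-disjoint stars; $S_{k,l}$ denotes the double star whose two stars have $k$ and $l$ leaves, so it has $k+l+2$ vertices. A monochromatic copy of a graph is a subgraph isomorphic to it all of whose edges have the same color. -}

module Defs where

open import Data.Nat using (ℕ; _≤_; _+_; _*_)
open import Data.Fin using (Fin; _≟_)
open import Data.List using (List; length; filter)
open import Data.List.Base using (allFin)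
open import Data.Product using (Σ; _×_; ∃; ∃-syntax)
open import Relation.Nullary using (¬_)
open import Relation.Nullary.Decidable using (_×-dec_; ¬?)
open import Relation.Binary.PropositionalEquality using (_≡_)
open import Function.Definitions using (Injective)

-- The colour of edge {u,v} (u ≢ v) is c u v; symmetry is required,
-- the values c v v on the diagonal are irrelevant (loops are not edges).
record Colouring (N r : ℕ) : Set where
  field
    col  : Fin N → Fin N → Fin r
    symm : ∀ u v → col u v ≡ col v u
open Colouring public

data DSVertex (k l : ℕ) : Set where
  centre₁ : DSVertex k l
  centre₂ : DSVertex k l
  leaf₁   : Fin k → DSVertex k l
  leaf₂   : Fin l → DSVertex k l

-- Edge relation of the double star S_{k,l} (one orientation per edge).
data DSEdge {k l : ℕ} : DSVertex k l → DSVertex k l → Set where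
  centres : DSEdge centre₁ centre₂
  left    : (a : Fin k) → DSEdge centre₁ (leaf₁ a)
  right   : (b : Fin l) → DSEdge centre₂ (leaf₂ b)

MonoCopy : ∀ {N r} → Colouring N r → (V : Set) → (V → V → Set) → Set
MonoCopy {N} {r} c V E =
  ∃[ i ] Σ (V → Fin N) λ φ →
    Injective _≡_ _≡_ φ × (∀ x y → E x y → col c (φ x) (φ y) ≡ i)

-- Double stars on 2n+2 vertices: S_{k,l} with k, l ≥ 1 and k + l = 2n.
IsDoubleStarParams : ℕ → ℕ → ℕ → Set
IsDoubleStarParams n k l = (1 ≤ k) × (1 ≤ l) × (k + l ≡ 2 * n)

degree : ∀ {N r} → Colouring N r → Fin N → Fin r → ℕ
degree {N} c v i =
  length (filter (λ w → ¬? (w ≟ v) ×-dec (col c v w Data.Fin.≟ i)) (allFin N))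

{-# OPTIONS --safe #-}
module Submission where

-- Call a colour-j edge xy a pair of centres if d_j(x) > 2n and d_j(y) > n. Given
-- centres, every S_{k,l} with k + l = 2n (say l ≤ n) is found greedily: l colour-j
-- neighbours of y other than x, then k colour-j neighbours of x avoiding y and those.
--
-- Without centres, weight a colour-degree d by big d = d if d > 2n and by small d = d
-- if d ≤ n (both 0 otherwise). Every colour-j neighbour of a vertex of big j-degree
-- then has small j-degree, so double counting the colour-j edges gives
-- ∑_x ∑_j big ≤ ∑_x ∑_j small. At a single vertex, summing small d + d ≤ big d + 2n
-- over the colours and using ∑_j d_j = N - 1 ≥ 2rn - n + 1 gives ∑_j small ≤ ∑_j big,
-- strictly as soon as some d_j lies outside (n, 2n]. Hence no degree does.

open import Defs
open import Algebra.Properties.CommutativeSemigroup using (x∙yz≈y∙xz; x∙yz≈z∙xy)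
open import Data.Bool using (true; false; if_then_else_)
open import Data.Empty using (⊥-elim)
open import Data.Fin using (Fin; zero; suc; _≟_)
open import Data.Fin.Properties using (any?; all?; suc-injective)
open import Data.List using (length; filter; tabulate)
open import Data.Nat using (ℕ; zero; suc; _≤_; _<_; _+_; _*_; z≤n; s≤s⁻¹; _≤?_; _<?_)
open import Data.Nat.Properties
  using ( +-*-semiring; +-commutativeSemigroup; +-identityʳ; *-identityʳ; +-comm; +-assoc; +-suc
        ; *-comm; *-assoc; ≤-reflexive; ≤-trans; ≤-antisym; ≤-<-trans; <-trans; <-irrefl
        ; <⇒≤; <⇒≱; ≰⇒>; ≮⇒≥; m≤m+n; m≤n+m; m≤n⇒m≤n+o; +-mono-≤; +-monoˡ-≤; +-monoʳ-≤
        ; +-monoʳ-<; +-cancelʳ-≤; +-cancelʳ-<; module ≤-Reasoning )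
open import Algebra.Properties.Semiring.Sum +-*-semiring
  using (sum; sum-syntax; sum-cong-≗; sum-replicate-zero; ∑-comm; ∑-distrib-+; *-distribˡ-sum)
open import Data.Product using (Σ-syntax; ∃-syntax; _×_; _,_; proj₁; proj₂)
open import Data.Sum using (_⊎_; inj₁; inj₂)
open import Data.Vec.Functional using ([]; _∷_)
open import Function using (_∘_; id)
open import Function.Definitions using (Injective)
open import Level using (Level)
open import Relation.Nullary using (Dec; yes; no; does; ¬_; ¬?; _×-dec_; contradiction)
open import Relation.Nullary.Decidable using (decidable-stable)
open import Relation.Unary using (Pred; Decidable)
open import Relation.Binary.PropositionalEquality
  using (_≡_; _≢_; refl; sym; trans; cong; subst; module ≡-Reasoning)

private variable
  a b : Level
  A B : Set a

∑-const : ∀ m c → ∑[ i < m ] c ≡ m * c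
∑-const zero    c = refl
∑-const (suc m) c = cong (c +_) (∑-const m c)

∑-mono-≤ : ∀ {m} {f g : Fin m → ℕ} → (∀ i → f i ≤ g i) → sum f ≤ sum g
∑-mono-≤ {zero}  f≤g = z≤n
∑-mono-≤ {suc m} f≤g = +-mono-≤ (f≤g zero) (∑-mono-≤ (f≤g ∘ suc))

≤-∑ : ∀ {m} (f : Fin m → ℕ) i → f i ≤ sum f
≤-∑ f zero    = m≤m+n _ _
≤-∑ f (suc i) = ≤-trans (≤-∑ (f ∘ suc) i) (m≤n+m _ _)

∑-mono-≤-+ : ∀ {m c} {f g : Fin m → ℕ} i → (∀ j → f j ≤ g j) → c + f i ≤ g i →
             c + sum f ≤ sum g
∑-mono-≤-+ {c = c} {f} {g} zero f≤g slack = begin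
  c + (f zero + sum (f ∘ suc)) ≡⟨ +-assoc c _ _ ⟨
  c + f zero + sum (f ∘ suc)   ≤⟨ +-mono-≤ slack (∑-mono-≤ (f≤g ∘ suc)) ⟩
  g zero + sum (g ∘ suc)       ∎
  where open ≤-Reasoning
∑-mono-≤-+ {c = c} {f} {g} (suc i) f≤g slack = begin
  c + (f zero + sum (f ∘ suc)) ≡⟨ x∙yz≈y∙xz +-commutativeSemigroup c (f zero) _ ⟩
  f zero + (c + sum (f ∘ suc)) ≤⟨ +-mono-≤ (f≤g zero) (∑-mono-≤-+ i (f≤g ∘ suc) slack) ⟩
  g zero + sum (g ∘ suc)       ∎
  where open ≤-Reasoning

∑-mono-< : ∀ {m} {f g : Fin m → ℕ} i → (∀ j → f j ≤ g j) → f i < g i → sum f < sum g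
∑-mono-< = ∑-mono-≤-+ {c = 1}

𝟙 : Dec A → ℕ
𝟙 a? = if does a? then 1 else 0

𝟙-yes : (a? : Dec A) → A → 𝟙 a? ≡ 1
𝟙-yes (yes _) _ = refl
𝟙-yes (no ¬a) a = contradiction a ¬a

𝟙-no : (a? : Dec A) → ¬ A → 𝟙 a? ≡ 0
𝟙-no (yes a) ¬a = contradiction a ¬a
𝟙-no (no _)  _  = refl

𝟙-mono : (A → B) → (a? : Dec A) (b? : Dec B) → 𝟙 a? ≤ 𝟙 b?
𝟙-mono A→B (yes a) b? = ≤-reflexive (sym (𝟙-yes b? (A→B a)))
𝟙-mono A→B (no _)  b? = z≤n

𝟙-⇔ : (A → B) → (B → A) → (a? : Dec A) (b? : Dec B) → 𝟙 a? ≡ 𝟙 b?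
𝟙-⇔ A→B B→A a? b? = ≤-antisym (𝟙-mono A→B a? b?) (𝟙-mono B→A b? a?)

𝟙-×-dec : (a? : Dec A) (b? : Dec B) → 𝟙 (a? ×-dec b?) ≡ 𝟙 a? * 𝟙 b?
𝟙-×-dec (yes _) b? = sym (+-identityʳ (𝟙 b?))
𝟙-×-dec (no _)  b? = refl

𝟙-¬? : (a? : Dec A) → 𝟙 (¬? a?) + 𝟙 a? ≡ 1
𝟙-¬? (yes _) = refl
𝟙-¬? (no _)  = refl

count : ∀ {N p} {P : Pred (Fin N) p} → Decidable P → ℕ
count {N} P? = ∑[ w < N ] 𝟙 (P? w)

length-filter-tabulate : ∀ {N p} {P : Pred A p} (P? : Decidable P) (f : Fin N → A) →
  length (filter P? (tabulate f)) ≡ ∑[ w < N ] 𝟙 (P? (f w))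
length-filter-tabulate {N = zero}  P? f = refl
length-filter-tabulate {N = suc N} P? f with does (P? (f zero))
... | true  = cong suc (length-filter-tabulate P? (f ∘ suc))
... | false = length-filter-tabulate P? (f ∘ suc)

count-x≟ : ∀ {N} (x : Fin N) → count (x ≟_) ≡ 1
count-x≟ {suc N} zero = cong suc (sum-replicate-zero N)
count-x≟ (suc x)      = count-x≟ x

count-≟x : ∀ {N} (x : Fin N) → count (_≟ x) ≡ 1
count-≟x {suc N} zero = cong suc (sum-replicate-zero N)
count-≟x (suc x)      = count-≟x x

Avoids : ∀ {N q} → (Fin q → Fin N) → Pred (Fin N) _
Avoids h w = ∀ b → w ≢ h b

avoids? : ∀ {N q} (h : Fin q → Fin N) → Decidable (Avoids h)
avoids? h w = all? (λ b → ¬? (w ≟ h b))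

module _ {N p} {P : Pred (Fin N) p} (P? : Decidable P) where

  count-¬? : count (¬? ∘ P?) + count P? ≡ N
  count-¬? = begin
    count (¬? ∘ P?) + count P?             ≡⟨ ∑-distrib-+ (𝟙 ∘ ¬? ∘ P?) (𝟙 ∘ P?) ⟨
    ∑[ w < N ] (𝟙 (¬? (P? w)) + 𝟙 (P? w))  ≡⟨ sum-cong-≗ (𝟙-¬? ∘ P?) ⟩
    ∑[ w < N ] 1                           ≡⟨ ∑-const N 1 ⟩
    N * 1                                  ≡⟨ *-identityʳ N ⟩
    N                                      ∎
    where open ≡-Reasoning

  count-fibres : ∀ {r} (f : Fin N → Fin r) →
    ∑[ j < r ] count (λ w → P? w ×-dec (f w ≟ j)) ≡ count P?
  count-fibres {r} f = begin
    ∑[ j < r ] ∑[ w < N ] 𝟙 (P? w ×-dec (f w ≟ j))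
      ≡⟨ ∑-comm (λ j w → 𝟙 (P? w ×-dec (f w ≟ j))) ⟩
    ∑[ w < N ] ∑[ j < r ] 𝟙 (P? w ×-dec (f w ≟ j))
      ≡⟨ sum-cong-≗ fibre ⟩
    count P?
      ∎
    where
    open ≡-Reasoning
    fibre : ∀ w → ∑[ j < r ] 𝟙 (P? w ×-dec (f w ≟ j)) ≡ 𝟙 (P? w)
    fibre w = begin
      ∑[ j < r ] 𝟙 (P? w ×-dec (f w ≟ j))   ≡⟨ sum-cong-≗ (𝟙-×-dec (P? w) ∘ (f w ≟_)) ⟩
      ∑[ j < r ] (𝟙 (P? w) * 𝟙 (f w ≟ j))   ≡⟨ *-distribˡ-sum (𝟙 (P? w)) (𝟙 ∘ (f w ≟_)) ⟨
      𝟙 (P? w) * count (f w ≟_)             ≡⟨ cong (𝟙 (P? w) *_) (count-x≟ (f w)) ⟩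
      𝟙 (P? w) * 1                          ≡⟨ *-identityʳ (𝟙 (P? w)) ⟩
      𝟙 (P? w)                              ∎

  count-avoiding : ∀ {q} (h : Fin q → Fin N) → count P? ≤ count (λ w → P? w ×-dec avoids? h w) + q
  count-avoiding {q} h = begin
    count P?
      ≤⟨ ∑-mono-≤ split ⟩
    ∑[ w < N ] (𝟙 (P∖h? w) + ∑[ b < q ] 𝟙 (w ≟ h b))
      ≡⟨ ∑-distrib-+ (𝟙 ∘ P∖h?) (λ w → ∑[ b < q ] 𝟙 (w ≟ h b)) ⟩
    count P∖h? + ∑[ w < N ] ∑[ b < q ] 𝟙 (w ≟ h b)
      ≡⟨ cong (count P∖h? +_) (∑-comm (λ w b → 𝟙 (w ≟ h b))) ⟩
    count P∖h? + ∑[ b < q ] count (_≟ h b)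
      ≡⟨ cong (count P∖h? +_) (sum-cong-≗ (count-≟x ∘ h)) ⟩
    count P∖h? + ∑[ b < q ] 1
      ≡⟨ cong (count P∖h? +_) (trans (∑-const q 1) (*-identityʳ q)) ⟩
    count P∖h? + q
      ∎
    where
    open ≤-Reasoning
    P∖h? : Decidable (λ w → P w × Avoids h w)
    P∖h? w = P? w ×-dec avoids? h w
    split : ∀ w → 𝟙 (P? w) ≤ 𝟙 (P∖h? w) + ∑[ b < q ] 𝟙 (w ≟ h b)
    split w with any? (λ b → w ≟ h b)
    ... | yes (b , w≡hb) =
      ≤-trans (𝟙-mono (λ _ → w≡hb) (P? w) (w ≟ h b)) (≤-trans (≤-∑ _ b) (m≤n+m _ _))
    ... | no ¬hit =
      ≤-trans (𝟙-mono (λ Pw → Pw , λ b w≡hb → ¬hit (b , w≡hb)) (P? w) (P∖h? w)) (m≤m+n _ _)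

distinct-witnesses : ∀ {N m p} {P : Pred (Fin N) p} (P? : Decidable P) → m ≤ count P? →
  Σ[ g ∈ (Fin m → Fin N) ] Injective _≡_ _≡_ g × (∀ a → P (g a))
distinct-witnesses {m = zero} P? _ = (λ ()) , (λ { {()} }) , (λ ())
distinct-witnesses {suc N} {suc m} P? m<count with P? zero
... | yes P0 = let g , g-inj , Pg = distinct-witnesses (P? ∘ suc) (s≤s⁻¹ m<count) in
  (zero ∷ suc ∘ g) , zero∷suc∘-injective g-inj , λ { zero → P0 ; (suc a) → Pg a }
  where
  zero∷suc∘-injective : ∀ {g : Fin m → Fin N} → Injective _≡_ _≡_ g →
    Injective _≡_ _≡_ (zero ∷ suc ∘ g)
  zero∷suc∘-injective g-inj {zero}  {zero}  _ = refl
  zero∷suc∘-injective g-inj {suc a} {suc b} e = cong suc (g-inj (suc-injective e))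
... | no _   = let g , g-inj , Pg = distinct-witnesses (P? ∘ suc) m<count in
  suc ∘ g , g-inj ∘ suc-injective , Pg

distinct-witnesses-avoiding : ∀ {N m q p} {P : Pred (Fin N) p} (P? : Decidable P)
  (h : Fin q → Fin N) → m + q ≤ count P? →
  Σ[ g ∈ (Fin m → Fin N) ] Injective _≡_ _≡_ g × (∀ a → P (g a) × Avoids h (g a))
distinct-witnesses-avoiding {m = m} {q} P? h m+q≤count =
  distinct-witnesses (λ w → P? w ×-dec avoids? h w)
    (+-cancelʳ-≤ q m _ (≤-trans m+q≤count (count-avoiding P? h)))

module _ {N ℓ} {E : Fin N → Pred (Fin N) ℓ} (E? : ∀ x → Decidable (E x))
         (E-sym : ∀ {x y} → E x y → E y x) where

  double-counting : ∀ {p q} {P : Pred (Fin N) p} {Q : Pred (Fin N) q}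
    (P? : Decidable P) (Q? : Decidable Q) → (∀ {x y} → P x → E x y → Q y) →
    ∑[ x < N ] (𝟙 (P? x) * count (E? x)) ≤ ∑[ y < N ] (𝟙 (Q? y) * count (E? y))
  double-counting P? Q? P-E→Q = begin
    ∑[ x < N ] (𝟙 (P? x) * count (E? x))
      ≡⟨ sum-cong-≗ (λ x → *-distribˡ-sum (𝟙 (P? x)) (𝟙 ∘ E? x)) ⟩
    ∑[ x < N ] ∑[ y < N ] (𝟙 (P? x) * 𝟙 (E? x y))
      ≤⟨ ∑-mono-≤ (λ x → ∑-mono-≤ (edge x)) ⟩
    ∑[ x < N ] ∑[ y < N ] (𝟙 (Q? y) * 𝟙 (E? x y))
      ≡⟨ ∑-comm (λ x y → 𝟙 (Q? y) * 𝟙 (E? x y)) ⟩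
    ∑[ y < N ] ∑[ x < N ] (𝟙 (Q? y) * 𝟙 (E? x y))
      ≡⟨ sum-cong-≗ (λ y → sum-cong-≗ (λ x → cong (𝟙 (Q? y) *_) (𝟙-sym x y))) ⟩
    ∑[ y < N ] ∑[ x < N ] (𝟙 (Q? y) * 𝟙 (E? y x))
      ≡⟨ sum-cong-≗ (λ y → *-distribˡ-sum (𝟙 (Q? y)) (𝟙 ∘ E? y)) ⟨
    ∑[ y < N ] (𝟙 (Q? y) * count (E? y))
      ∎
    where
    open ≤-Reasoning
    𝟙-sym : ∀ x y → 𝟙 (E? x y) ≡ 𝟙 (E? y x)
    𝟙-sym x y = 𝟙-⇔ E-sym E-sym (E? x y) (E? y x)
    edge : ∀ x y → 𝟙 (P? x) * 𝟙 (E? x y) ≤ 𝟙 (Q? y) * 𝟙 (E? x y)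
    edge x y = begin
      𝟙 (P? x) * 𝟙 (E? x y)
        ≡⟨ 𝟙-×-dec (P? x) (E? x y) ⟨
      𝟙 (P? x ×-dec E? x y)
        ≤⟨ 𝟙-mono (λ (Px , Exy) → P-E→Q Px Exy , Exy) (P? x ×-dec E? x y) (Q? y ×-dec E? x y) ⟩
      𝟙 (Q? y ×-dec E? x y)
        ≡⟨ 𝟙-×-dec (Q? y) (E? x y) ⟩
      𝟙 (Q? y) * 𝟙 (E? x y)
        ∎

m+n≡2o∧o<n⇒m<o : ∀ {m n o} → m + n ≡ 2 * o → o < n → m < o
m+n≡2o∧o<n⇒m<o {m} {n} {o} m+n≡2o o<n = +-cancelʳ-< o m o (begin-strict
  m + o   <⟨ +-monoʳ-< m o<n ⟩
  m + n   ≡⟨ m+n≡2o ⟩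
  2 * o   ≡⟨ cong (o +_) (+-identityʳ o) ⟩
  o + o   ∎)
  where open ≤-Reasoning

¬unbalanced⇒balanced : ∀ {n d} → ¬ (d ≤ n ⊎ 2 * n < d) → (n + 1 ≤ d) × (d ≤ 2 * n)
¬unbalanced⇒balanced {n} {d} ¬unbalanced =
  subst (_≤ d) (+-comm 1 n) (≰⇒> (¬unbalanced ∘ inj₁)) , ≮⇒≥ (¬unbalanced ∘ inj₂)

big small : ℕ → ℕ → ℕ
big   n d = 𝟙 (2 * n <? d) * d
small n d = 𝟙 (d ≤? n) * d

small-≤ : ∀ {n d} → d ≤ n → small n d ≡ d
small-≤ {n} {d} d≤n = trans (cong (_* d) (𝟙-yes (d ≤? n) d≤n)) (+-identityʳ d)

small-vanishes : ∀ {n d} → n < d → small n d ≡ 0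
small-vanishes {n} {d} n<d = cong (_* d) (𝟙-no (d ≤? n) (<⇒≱ n<d))

big-large : ∀ {n d} → 2 * n < d → big n d ≡ d
big-large {n} {d} 2n<d = trans (cong (_* d) (𝟙-yes (2 * n <? d) 2n<d)) (+-identityʳ d)

small+d≤big+2n : ∀ n d → small n d + d ≤ big n d + 2 * n
small+d≤big+2n n d with d ≤? n
... | yes d≤n = begin
  small n d + d     ≡⟨ cong (_+ d) (small-≤ {n} d≤n) ⟩
  d + d             ≤⟨ +-mono-≤ d≤n (m≤n⇒m≤n+o 0 d≤n) ⟩
  2 * n             ≤⟨ m≤n+m (2 * n) (big n d) ⟩
  big n d + 2 * n   ∎
  where open ≤-Reasoning
... | no d≰n with 2 * n <? d
...   | yes 2n<d = begin
  small n d + d     ≡⟨ cong (_+ d) (small-vanishes {n} (≰⇒> d≰n)) ⟩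
  d                 ≤⟨ m≤m+n d (2 * n) ⟩
  d + 2 * n         ≡⟨ cong (_+ 2 * n) (big-large {n} 2n<d) ⟨
  big n d + 2 * n   ∎
  where open ≤-Reasoning
...   | no 2n≮d = begin
  small n d + d     ≡⟨ cong (_+ d) (small-vanishes {n} (≰⇒> d≰n)) ⟩
  d                 ≤⟨ ≮⇒≥ 2n≮d ⟩
  2 * n             ≤⟨ m≤n+m (2 * n) (big n d) ⟩
  big n d + 2 * n   ∎
  where open ≤-Reasoning

large⇒small+d≡big : ∀ {n d} → 2 * n < d → small n d + d ≡ big n d
large⇒small+d≡big {n} {d} 2n<d = trans
  (cong (_+ d) (small-vanishes {n} (≤-<-trans (m≤m+n n (n + 0)) 2n<d)))
  (sym (big-large {n} 2n<d))

module _ {r} (n : ℕ) (d : Fin r → ℕ) (slack : r * (2 * n) < ∑[ j < r ] d j + n) where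

  private
    large⊎bounded : (∃[ j ] 2 * n < d j) ⊎ (∀ j → d j ≤ 2 * n)
    large⊎bounded with any? (λ j → 2 * n <? d j)
    ... | yes large = inj₁ large
    ... | no ¬large = inj₂ (λ j → ≮⇒≥ (¬large ∘ (j ,_)))

  large⇒∑small<∑big : ∀ {j₀} → 2 * n < d j₀ →
    ∑[ j < r ] small n (d j) < ∑[ j < r ] big n (d j)
  large⇒∑small<∑big {j₀} large = +-cancelʳ-< (∑d + n) ∑s ∑b (begin-strict
    ∑s + (∑d + n)
      ≡⟨ x∙yz≈z∙xy +-commutativeSemigroup ∑s ∑d n ⟩
    n + (∑s + ∑d)
      ≤⟨ +-monoˡ-≤ (∑s + ∑d) (m≤m+n n (n + 0)) ⟩
    2 * n + (∑s + ∑d)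
      ≡⟨ cong (2 * n +_) (∑-distrib-+ (small n ∘ d) d) ⟨
    2 * n + ∑[ j < r ] (small n (d j) + d j)
      ≤⟨ ∑-mono-≤-+ j₀ (λ j → small+d≤big+2n n (d j)) at-j₀ ⟩
    ∑[ j < r ] (big n (d j) + 2 * n)
      ≡⟨ ∑-distrib-+ (big n ∘ d) (λ _ → 2 * n) ⟩
    ∑b + ∑[ j < r ] (2 * n)
      ≡⟨ cong (∑b +_) (∑-const r (2 * n)) ⟩
    ∑b + r * (2 * n)
      <⟨ +-monoʳ-< ∑b slack ⟩
    ∑b + (∑d + n)
      ∎)
    where
    open ≤-Reasoning
    ∑s ∑b ∑d : ℕ
    ∑s = ∑[ j < r ] small n (d j)
    ∑b = ∑[ j < r ] big n (d j)
    ∑d = ∑[ j < r ] d j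
    at-j₀ : 2 * n + (small n (d j₀) + d j₀) ≤ big n (d j₀) + 2 * n
    at-j₀ = ≤-reflexive (trans (+-comm (2 * n) _) (cong (_+ 2 * n) (large⇒small+d≡big {n} large)))

  bounded⇒medium : (∀ j → d j ≤ 2 * n) → ∀ j → n < d j
  bounded⇒medium bounded j = ≰⇒> λ d≤n → <⇒≱ slack (begin
    ∑[ j < r ] d j + n    ≡⟨ +-comm _ n ⟩
    n + ∑[ j < r ] d j    ≤⟨ ∑-mono-≤-+ j bounded (+-monoʳ-≤ n (m≤n⇒m≤n+o 0 d≤n)) ⟩
    ∑[ j < r ] (2 * n)    ≡⟨ ∑-const r (2 * n) ⟩
    r * (2 * n)           ∎)
    where open ≤-Reasoning

  ∑small≤∑big : ∑[ j < r ] small n (d j) ≤ ∑[ j < r ] big n (d j)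
  ∑small≤∑big with large⊎bounded
  ... | inj₁ (_ , large) = <⇒≤ (large⇒∑small<∑big large)
  ... | inj₂ bounded     = begin
    ∑[ j < r ] small n (d j)   ≡⟨ sum-cong-≗ (small-vanishes {n} ∘ bounded⇒medium bounded) ⟩
    ∑[ j < r ] 0               ≡⟨ sum-replicate-zero r ⟩
    0                          ≤⟨ z≤n ⟩
    ∑[ j < r ] big n (d j)     ∎
    where open ≤-Reasoning

  unbalanced⇒∑small<∑big : ∀ j → d j ≤ n ⊎ 2 * n < d j →
    ∑[ j < r ] small n (d j) < ∑[ j < r ] big n (d j)
  unbalanced⇒∑small<∑big j (inj₂ large) = large⇒∑small<∑big large
  unbalanced⇒∑small<∑big j (inj₁ d≤n) with large⊎bounded
  ... | inj₁ (_ , large) = large⇒∑small<∑big large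
  ... | inj₂ bounded     = contradiction d≤n (<⇒≱ (bounded⇒medium bounded j))

swapCentres : ∀ {k l} → DSVertex k l → DSVertex l k
swapCentres centre₁   = centre₂
swapCentres centre₂   = centre₁
swapCentres (leaf₁ a) = leaf₂ a
swapCentres (leaf₂ b) = leaf₁ b

swapCentres-involutive : ∀ {k l} (u : DSVertex k l) → swapCentres (swapCentres u) ≡ u
swapCentres-involutive centre₁   = refl
swapCentres-involutive centre₂   = refl
swapCentres-involutive (leaf₁ a) = refl
swapCentres-involutive (leaf₂ b) = refl

swapCentres-injective : ∀ {k l} → Injective _≡_ _≡_ (swapCentres {k} {l})
swapCentres-injective {x = u} {v} e =
  trans (sym (swapCentres-involutive u)) (trans (cong swapCentres e) (swapCentres-involutive v))

module _ {N r} (c : Colouring N r) where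

  Adj : Fin r → Fin N → Pred (Fin N) _
  Adj i v w = w ≢ v × col c v w ≡ i

  adj? : ∀ i v → Decidable (Adj i v)
  adj? i v w = ¬? (w ≟ v) ×-dec (col c v w ≟ i)

  Adj-sym : ∀ {i v w} → Adj i v w → Adj i w v
  Adj-sym {v = v} {w} (w≢v , vw≡i) = w≢v ∘ sym , trans (symm c w v) vw≡i

  degree≡count : ∀ v i → degree c v i ≡ count (adj? i v)
  degree≡count v i = length-filter-tabulate (adj? i v) id

  ∑-degree : ∀ v → ∑[ i < r ] degree c v i + 1 ≡ N
  ∑-degree v = begin
    ∑[ i < r ] degree c v i + 1          ≡⟨ cong (_+ 1) (sum-cong-≗ (degree≡count v)) ⟩
    ∑[ i < r ] count (adj? i v) + 1      ≡⟨ cong (_+ 1) (count-fibres (¬? ∘ (_≟ v)) (col c v)) ⟩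
    count (¬? ∘ (_≟ v)) + 1              ≡⟨ cong (count (¬? ∘ (_≟ v)) +_) (count-≟x v) ⟨
    count (¬? ∘ (_≟ v)) + count (_≟ v)   ≡⟨ count-¬? (_≟ v) ⟩
    N                                    ∎
    where open ≡-Reasoning

  doubleStar-swap : ∀ {k l} → MonoCopy c (DSVertex l k) DSEdge → MonoCopy c (DSVertex k l) DSEdge
  doubleStar-swap (i , φ , φ-inj , φ-mono) =
    i , φ ∘ swapCentres , swapCentres-injective ∘ φ-inj , mono
    where
    mono : ∀ u v → DSEdge u v → col c (φ (swapCentres u)) (φ (swapCentres v)) ≡ i
    mono _ _ centres   = trans (symm c _ _) (φ-mono _ _ centres)
    mono _ _ (left a)  = φ-mono _ _ (right a)
    mono _ _ (right b) = φ-mono _ _ (left b)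

  doubleStar-embedding : ∀ {j x y k l} → Adj j x y →
    (gy : Fin l → Fin N) → Injective _≡_ _≡_ gy →
    (∀ b → Adj j y (gy b) × Avoids (x ∷ []) (gy b)) →
    (gx : Fin k → Fin N) → Injective _≡_ _≡_ gx →
    (∀ a → Adj j x (gx a) × Avoids (y ∷ gy) (gx a)) →
    MonoCopy c (DSVertex k l) DSEdge
  doubleStar-embedding {j} {x} {y} {k} {l} xy gy gy-inj gy-ok gx gx-inj gx-ok =
    j , φ , φ-inj , φ-mono
    where
    φ : DSVertex k l → Fin N
    φ centre₁   = x
    φ centre₂   = y
    φ (leaf₁ a) = gx a
    φ (leaf₂ b) = gy b
    y≢x : y ≢ x
    y≢x = proj₁ xy
    gx≢x : ∀ a → gx a ≢ x
    gx≢x a = proj₁ (proj₁ (gx-ok a))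
    gx≢y : ∀ a → gx a ≢ y
    gx≢y a = proj₂ (gx-ok a) zero
    gx≢gy : ∀ a b → gx a ≢ gy b
    gx≢gy a b = proj₂ (gx-ok a) (suc b)
    gy≢y : ∀ b → gy b ≢ y
    gy≢y b = proj₁ (proj₁ (gy-ok b))
    gy≢x : ∀ b → gy b ≢ x
    gy≢x b = proj₂ (gy-ok b) zero
    φ-inj : Injective _≡_ _≡_ φ
    φ-inj {centre₁} {centre₁}  _ = refl
    φ-inj {centre₁} {centre₂}  e = ⊥-elim (y≢x (sym e))
    φ-inj {centre₁} {leaf₁ a}  e = ⊥-elim (gx≢x a (sym e))
    φ-inj {centre₁} {leaf₂ b}  e = ⊥-elim (gy≢x b (sym e))
    φ-inj {centre₂} {centre₁}  e = ⊥-elim (y≢x e)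
    φ-inj {centre₂} {centre₂}  _ = refl
    φ-inj {centre₂} {leaf₁ a}  e = ⊥-elim (gx≢y a (sym e))
    φ-inj {centre₂} {leaf₂ b}  e = ⊥-elim (gy≢y b (sym e))
    φ-inj {leaf₁ a} {centre₁}  e = ⊥-elim (gx≢x a e)
    φ-inj {leaf₁ a} {centre₂}  e = ⊥-elim (gx≢y a e)
    φ-inj {leaf₁ a} {leaf₁ a′} e = cong leaf₁ (gx-inj e)
    φ-inj {leaf₁ a} {leaf₂ b}  e = ⊥-elim (gx≢gy a b e)
    φ-inj {leaf₂ b} {centre₁}  e = ⊥-elim (gy≢x b e)
    φ-inj {leaf₂ b} {centre₂}  e = ⊥-elim (gy≢y b e)
    φ-inj {leaf₂ b} {leaf₁ a}  e = ⊥-elim (gx≢gy a b (sym e))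
    φ-inj {leaf₂ b} {leaf₂ b′} e = cong leaf₂ (gy-inj e)
    φ-mono : ∀ u v → DSEdge u v → col c (φ u) (φ v) ≡ j
    φ-mono _ _ centres   = proj₂ xy
    φ-mono _ _ (left a)  = proj₂ (proj₁ (gx-ok a))
    φ-mono _ _ (right b) = proj₂ (proj₁ (gy-ok b))

  doubleStar : ∀ {j x y k l} → Adj j x y → k + l < degree c x j → l < degree c y j →
    MonoCopy c (DSVertex k l) DSEdge
  doubleStar {j} {x} {y} {k} {l} xy x-deg y-deg =
    let gy , gy-inj , gy-ok = distinct-witnesses-avoiding (adj? j y) (x ∷ []) room-at-y
        gx , gx-inj , gx-ok = distinct-witnesses-avoiding (adj? j x) (y ∷ gy) room-at-x
    in  doubleStar-embedding xy gy gy-inj gy-ok gx gx-inj gx-ok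
    where
    open ≤-Reasoning
    room-at-y : l + 1 ≤ count (adj? j y)
    room-at-y = begin
      l + 1              ≡⟨ +-comm l 1 ⟩
      suc l              ≤⟨ y-deg ⟩
      degree c y j       ≡⟨ degree≡count y j ⟩
      count (adj? j y)   ∎
    room-at-x : k + suc l ≤ count (adj? j x)
    room-at-x = begin
      k + suc l          ≡⟨ +-suc k l ⟩
      suc (k + l)        ≤⟨ x-deg ⟩
      degree c x j       ≡⟨ degree≡count x j ⟩
      count (adj? j x)   ∎

module _ {N r} (c : Colouring N r) (n : ℕ) where

  DoubleStarCentres : Set
  DoubleStarCentres = ∃[ j ] ∃[ x ] ∃[ y ] Adj c j x y × 2 * n < degree c x j × n < degree c y j

  doubleStarCentres? : Dec DoubleStarCentres
  doubleStarCentres? = any? λ j → any? λ x → any? λ y →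
    adj? c j x y ×-dec 2 * n <? degree c x j ×-dec n <? degree c y j

  centres⇒doubleStars : DoubleStarCentres →
    ∀ k l → IsDoubleStarParams n k l → MonoCopy c (DSVertex k l) DSEdge
  centres⇒doubleStars (j , x , y , xy , x-large , y-medium) k l (_ , _ , k+l≡2n) with l ≤? n
  ... | yes l≤n = doubleStar c xy
    (subst (_< degree c x j) (sym k+l≡2n) x-large)
    (≤-<-trans l≤n y-medium)
  ... | no l≰n  = doubleStar-swap c (doubleStar c xy
    (subst (_< degree c x j) (trans (sym k+l≡2n) (+-comm k l)) x-large)
    (<-trans (m+n≡2o∧o<n⇒m<o k+l≡2n (≰⇒> l≰n)) y-medium))

  ¬centres⇒∑big≤∑small : ¬ DoubleStarCentres →
    ∀ j → ∑[ x < N ] big n (degree c x j) ≤ ∑[ x < N ] small n (degree c x j)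
  ¬centres⇒∑big≤∑small ¬centres j = begin
    ∑[ x < N ] big n (degree c x j)
      ≡⟨ sum-cong-≗ (λ x → cong (𝟙 (large? x) *_) (degree≡count c x j)) ⟩
    ∑[ x < N ] (𝟙 (large? x) * count (adj? c j x))
      ≤⟨ double-counting (adj? c j) (Adj-sym c) large? small? large-edge⇒small ⟩
    ∑[ y < N ] (𝟙 (small? y) * count (adj? c j y))
      ≡⟨ sum-cong-≗ (λ y → cong (𝟙 (small? y) *_) (degree≡count c y j)) ⟨
    ∑[ y < N ] small n (degree c y j)
      ∎
    where
    open ≤-Reasoning
    large? : Decidable (λ x → 2 * n < degree c x j)
    large? x = 2 * n <? degree c x j
    small? : Decidable (λ y → degree c y j ≤ n)
    small? y = degree c y j ≤? n
    large-edge⇒small : ∀ {x y} → 2 * n < degree c x j → Adj c j x y → degree c y j ≤ n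
    large-edge⇒small x-large xy =
      decidable-stable (small? _) λ y≰n → ¬centres (j , _ , _ , xy , x-large , ≰⇒> y≰n)

  vertex-slack : 2 * r * n + 2 ≤ N + n → ∀ v → r * (2 * n) < ∑[ i < r ] degree c v i + n
  vertex-slack N-large v = s≤s⁻¹ (begin
    2 + r * (2 * n)                     ≡⟨ +-comm 2 _ ⟩
    r * (2 * n) + 2                     ≡⟨ cong (_+ 2) 2rn≡r2n ⟨
    2 * r * n + 2                       ≤⟨ N-large ⟩
    N + n                               ≡⟨ cong (_+ n) (∑-degree c v) ⟨
    ∑[ i < r ] degree c v i + 1 + n     ≡⟨ +-assoc _ 1 n ⟩
    ∑[ i < r ] degree c v i + suc n     ≡⟨ +-suc _ n ⟩
    suc (∑[ i < r ] degree c v i + n)   ∎)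
    where
    open ≤-Reasoning
    2rn≡r2n : 2 * r * n ≡ r * (2 * n)
    2rn≡r2n = trans (cong (_* n) (*-comm 2 r)) (*-assoc r 2 n)

  ¬centres⇒¬unbalanced : 2 * r * n + 2 ≤ N + n → ¬ DoubleStarCentres →
    ∀ v i → ¬ (degree c v i ≤ n ⊎ 2 * n < degree c v i)
  ¬centres⇒¬unbalanced N-large ¬centres v i unbalanced = <-irrefl refl (begin-strict
    ∑[ x < N ] ∑[ j < r ] small n (degree c x j)
      <⟨ ∑-mono-< v at-vertex (unbalanced⇒∑small<∑big n _ (vertex-slack N-large v) i unbalanced) ⟩
    ∑[ x < N ] ∑[ j < r ] big n (degree c x j)
      ≡⟨ ∑-comm (λ x j → big n (degree c x j)) ⟩
    ∑[ j < r ] ∑[ x < N ] big n (degree c x j)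
      ≤⟨ ∑-mono-≤ (¬centres⇒∑big≤∑small ¬centres) ⟩
    ∑[ j < r ] ∑[ x < N ] small n (degree c x j)
      ≡⟨ ∑-comm (λ j x → small n (degree c x j)) ⟩
    ∑[ x < N ] ∑[ j < r ] small n (degree c x j)
      ∎)
    where
    open ≤-Reasoning
    at-vertex : ∀ x → ∑[ j < r ] small n (degree c x j) ≤ ∑[ j < r ] big n (degree c x j)
    at-vertex x = ∑small≤∑big n (degree c x) (vertex-slack N-large x)

lemma2p2 : (r n N : ℕ) → 2 ≤ r → 1 ≤ n → 2 * r * n + 2 ≤ N + n →
    (c : Colouring N r) →
    ((k l : ℕ) → IsDoubleStarParams n k l → MonoCopy c (DSVertex k l) DSEdge)
    ⊎ ((v : Fin N) (i : Fin r) → (n + 1 ≤ degree c v i) × (degree c v i ≤ 2 * n))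
lemma2p2 r n N _ _ N-large c with doubleStarCentres? c n
... | yes has-centres = inj₁ (centres⇒doubleStars c n has-centres)
... | no ¬centres     =
  inj₂ λ v i → ¬unbalanced⇒balanced (¬centres⇒¬unbalanced c n N-large ¬centres v i)
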